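{- For every integer $k > 1$, $\mathrm{ATIME}^{op}[\log^k n, 1] \subsetneq \mathrm{ATIME}^{op}[\log^{k+1} n, 1]$.
   Context: Throughout, $\log n$ denotes $\log_2 n$ and $\log^k n$ denotes $(\log n)^k$. A random-access Turing machine is a multi-tape Turing machine with a read-only random-access input of length $n+1$ (the input binary string followed by an endmark $\triangleleft$), a fixed number of read-write working tapes, and a read-write input address-tape of length $\lceil\log n\rceil$; at each step the binary number on the address-tape determines which input cell is read (the endmark cell if the number exceeds $n$). A random-access alternating Turing machine is such a machine whose states are partitioned into existential and universal states, with the usual alternating acceptance condition (a configuration is accepting iff it is in an accepting final state, or it is existential and some successor configuration is accepting, or it is universal, has a successor, and all successor configurations are accepting). $\mathrm{ATIME}^{op}[f(n), m]$ is the class of languages of binary strings accepted by a random-access alternating Turing machine that starts in a universal state, makes at most $O(f(n))$ steps on inputs of length $n$, and whose computations have at most $m$ alternating blocks of universal/existential states (i.e. at most $m-1$ alternations). In particular $\mathrm{ATIME}^{op}[f(n),1]$ corresponds to machines using only universal states. -}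

module Defs where

open import Data.Nat using (ℕ; zero; suc; _+_; _*_; _^_; _<ᵇ_; _≡ᵇ_)
open import Data.Nat.Logarithm using (⌈log₂_⌉)
open import Data.Bool using (Bool; true; false; if_then_else_)
open import Data.Maybe using (Maybe; just; nothing)
open import Data.Fin using (Fin)
import Data.Fin
open import Data.List using (List; []; _∷_; map; length; lookup)
open import Data.List.Relation.Unary.All using (All)
open import Data.List.Relation.Unary.Any using (Any)
open import Data.Product using (Σ; ∃; _×_; _,_)
open import Relation.Binary.PropositionalEquality using (_≡_; _≢_)
open import Relation.Nullary using (¬_)
open import Function.Bundles using (_⇔_)

data Move : Set where
  left stay right : Move

data Kind : Set where
  accepting rejecting universal existential : Kind

-- One transition: q states, work alphabet Fin (suc g) (blank = zero),
-- w working tapes.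
record Action (q g w : ℕ) : Set where
  field
    next      : Fin q
    workWrite : Fin w → Fin (suc g)
    workMove  : Fin w → Move
    addrWrite : Bool
    addrMove  : Move

record RATM : Set where
  field
    q g w : ℕ                     -- number of states, work-alphabet size - 1, number of work tapes
    start : Fin q
    kind  : Fin q → Kind
    -- transition relation (finitely branching): current state, symbol read on the
    -- input (nothing = endmark), symbol under the address-tape head (nothing = the
    -- head is past the last address cell), symbols under the work heads
    δ     : Fin q → Maybe Bool → Maybe Bool → (Fin w → Fin (suc g)) → List (Action q g w)

record Tape (A : Set) : Set where
  constructor tape
  field
    cells : ℕ → A
    head  : ℕ

moveHead : Move → ℕ → ℕ
moveHead left  zero    = zero
moveHead left  (suc h) = h
moveHead stay  h       = h
moveHead right h       = suc h

writeAt : {A : Set} → ℕ → A → (ℕ → A) → ℕ → A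
writeAt h a f i = if i ≡ᵇ h then a else f i

stepTape : {A : Set} → A → Move → Tape A → Tape A
stepTape a m (tape c h) = tape (writeAt h a c) (moveHead m h)

-- The address tape has exactly L cells (L = ⌈log n⌉); the head ranges over 0..L,
-- position L meaning "beyond the last cell" (reads nothing, writes ignored).
addrMoveHead : ℕ → Move → ℕ → ℕ
addrMoveHead L right h = if h <ᵇ L then suc h else h
addrMoveHead L m     h = moveHead m h

stepAddr : ℕ → Bool → Move → Tape Bool → Tape Bool
stepAddr L b m (tape c h) =
  tape (if h <ᵇ L then writeAt h b c else c) (addrMoveHead L m h)

readAddr : ℕ → Tape Bool → Maybe Bool
readAddr L (tape c h) = if h <ᵇ L then just (Tape.cells (tape c h) h) else nothing

bitVal : Bool → ℕ
bitVal true  = 1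
bitVal false = 0

addrValue : ℕ → (ℕ → Bool) → ℕ
addrValue zero    c = 0
addrValue (suc L) c = addrValue L c + bitVal (c L) * 2 ^ L

readInput : List Bool → ℕ → Maybe Bool
readInput []       _       = nothing
readInput (b ∷ bs) zero    = just b
readInput (b ∷ bs) (suc i) = readInput bs i

module _ (M : RATM) where
  open RATM M

  record Config : Set where
    constructor config
    field
      state : Fin q
      work  : Fin w → Tape (Fin (suc g))
      addr  : Tape Bool

  initial : Config
  initial = config start (λ _ → tape (λ _ → Data.Fin.zero) 0) (tape (λ _ → false) 0)

  apply : ℕ → Action q g w → Config → Config
  apply L a (config s t ad) =
    config (Action.next a)
           (λ j → stepTape (Action.workWrite a j) (Action.workMove a j) (t j))
           (stepAddr L (Action.addrWrite a) (Action.addrMove a) ad)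

  succs : List Bool → Config → List Config
  succs x (config s t ad) with kind s
  ... | accepting = []
  ... | rejecting = []
  ... | _ = map (λ a → apply L a (config s t ad))
                (δ s (readInput x (addrValue L (Tape.cells ad)))
                     (readAddr L ad)
                     (λ j → Tape.cells (t j) (Tape.head (t j))))
    where L = ⌈log₂ length x ⌉

  data Acc (x : List Bool) : Config → Set where
    acc-final : ∀ C → kind (Config.state C) ≡ accepting → Acc x C
    acc-exist : ∀ C → kind (Config.state C) ≡ existential →
                Any (Acc x) (succs x C) → Acc x C
    acc-univ  : ∀ C → kind (Config.state C) ≡ universal →
                succs x C ≢ [] → All (Acc x) (succs x C) → Acc x C

  Accepts : List Bool → Set
  Accepts x = Acc x initial

  BoundedBy : List Bool → ℕ → Config → Set
  BoundedBy x zero    C = succs x C ≡ []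
  BoundedBy x (suc t) C = All (BoundedBy x t) (succs x C)

Language : Set₁
Language = List Bool → Set

-- ATIME^op[f(n), 1]: accepted by a random-access alternating TM that starts in a
-- universal state, uses only universal (and final) states, and makes O(f(n)) steps.
ATIME1 : (ℕ → ℕ) → Language → Set
ATIME1 f Lang =
  Σ RATM λ M →
    (RATM.kind M (RATM.start M) ≡ universal) ×
    (∀ s → RATM.kind M s ≢ existential) ×
    (∃ λ c → ∀ x → BoundedBy M x (c * (f (length x) + 1)) (initial M)) ×
    (∀ x → Lang x ⇔ Accepts M x)

logPow : ℕ → ℕ → ℕ
logPow k n = ⌈log₂ n ⌉ ^ k

_⊆ᶜ_ : (Language → Set) → (Language → Set) → Set₁
C ⊆ᶜ D = ∀ Lang → C Lang → D Lang

_⊊ᶜ_ : (Language → Set) → (Language → Set) → Set₁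
C ⊊ᶜ D = (C ⊆ᶜ D) × (Σ Language λ Lang → D Lang × ¬ C Lang)

-- A purely universal machine accepts x iff all its computation paths accept, and a path of
-- t steps queries at most t + 1 input cells. Hence if zeroing any one cell outside any t + 1
-- given cells yields an accepted word, x itself is accepted: along each path, zero a cell the
-- path never queries. With L = ⌈log n⌉ = 1 + (k + 1) m, the words having a 0 at one of the
-- addresses 1 + 2^j₀ + ⋯ + 2^jₖ (0 < j₀ < ⋯ < jₖ < L) therefore escape time c (log^k n + 1):
-- the all-ones word is rejected, yet zeroing any of those at least m^(k+1) addresses makes it
-- accepted. A deterministic machine, however, enumerates these addresses on its address tape
-- with k + 1 nested sweeps in O(log^(k+1) n) steps.
module Submission where

open import Defs
open import Data.Bool using (Bool; true; false; if_then_else_)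
open import Data.Empty using (⊥-elim)
open import Data.Fin using (Fin; toℕ)
import Data.Fin as Fin
open import Data.Fin.Properties using (toℕ-fromℕ<)
open import Data.List using (List; []; _∷_; map; length; _++_; replicate)
open import Data.List.Properties using (length-++; length-replicate; length-removeAt′)
open import Data.List.Membership.Propositional using (_∈_; _∉_; _─_)
open import Data.List.Relation.Unary.All as All using (All; []; _∷_)
import Data.List.Relation.Unary.All.Properties as All
open import Data.List.Relation.Unary.AllPairs as AllPairs using (AllPairs; []; _∷_)
import Data.List.Relation.Unary.AllPairs.Properties as AllPairs
open import Data.List.Relation.Unary.Any as Any using (Any; here; there; index)
import Data.List.Relation.Unary.Any.Properties as Any
open import Data.List.Relation.Unary.Unique.Propositional using (Unique)
open import Data.Maybe using (Maybe; just; nothing)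
open import Data.Nat using (ℕ; zero; suc; pred; _+_; _*_; _^_; _<ᵇ_; _≡ᵇ_; _≤_; _<_; _>_; _≟_;
  z≤n; s≤s; z<s; s≤s⁻¹; s<s⁻¹; NonZero; >-nonZero)
open import Data.List.Membership.DecPropositional _≟_ using (_∈?_)
open import Data.Nat.DivMod using (_mod_; m<n⇒m%n≡m)
open import Data.Nat.Logarithm using (⌈log₂_⌉; ⌈log₂2^n⌉≡n)
open import Data.Nat.Properties
open import Data.Nat.Solver using (module +-*-Solver)
open import Algebra.Properties.CommutativeSemigroup *-commutativeSemigroup using (x∙yz≈y∙xz)
open import Data.Product using (∃-syntax; _×_; _,_; proj₂)
open import Data.Sum using (_⊎_; inj₁; inj₂)
open import Function using (_∘_; case_of_)
open import Function.Bundles using (Equivalence; mk⇔)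
open import Relation.Binary.PropositionalEquality
open import Relation.Nullary using (¬_; yes; no)

module _ (M : RATM) (x : List Bool) where

  BoundedBy-mono : ∀ {t t′} C → t ≤ t′ → BoundedBy M x t C → BoundedBy M x t′ C
  BoundedBy-mono {zero}  {zero}   C _         stuck = stuck
  BoundedBy-mono {zero}  {suc _}  C _         stuck rewrite stuck = []
  BoundedBy-mono {suc _} {suc _}  C (s≤s t≤t′) bounded =
    All.map (λ {C′} → BoundedBy-mono C′ t≤t′) bounded

  succs-accepting : ∀ C → RATM.kind M (Config.state C) ≡ accepting → succs M x C ≡ []
  succs-accepting (config s _ _) accept with RATM.kind M s | accept
  ... | .accepting | refl = refl

ATIME1-mono : ∀ {f g} → (∀ n → f n ≤ g n) → ATIME1 f ⊆ᶜ ATIME1 g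
ATIME1-mono f≤g _ (N , startUniversal , noExistential , (c , bounded) , language) =
  N , startUniversal , noExistential ,
  (c , λ x → BoundedBy-mono N x (initial N) (*-monoʳ-≤ c (+-monoˡ-≤ 1 (f≤g (length x)))) (bounded x)) ,
  language

logPow-mono : ∀ {k} → 1 ≤ k → ∀ n → logPow k n ≤ logPow (suc k) n
logPow-mono {suc k} _ n with ⌈log₂ n ⌉
... | zero  = z≤n
... | suc ℓ = m≤n*m (suc ℓ ^ suc k) (suc ℓ)

-- Universal machines reading few input cells

zeroAt : List Bool → ℕ → List Bool
zeroAt []       _       = []
zeroAt (_ ∷ bs) zero    = false ∷ bs
zeroAt (b ∷ bs) (suc i) = b ∷ zeroAt bs i

length-zeroAt : ∀ x i → length (zeroAt x i) ≡ length x
length-zeroAt []      _       = refl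
length-zeroAt (_ ∷ _) zero    = refl
length-zeroAt (_ ∷ x) (suc i) = cong suc (length-zeroAt x i)

readInput-zeroAt-≢ : ∀ x {i j} → j ≢ i → readInput (zeroAt x i) j ≡ readInput x j
readInput-zeroAt-≢ []      {_}     {_}     _   = refl
readInput-zeroAt-≢ (_ ∷ _) {zero}  {zero}  j≢i = ⊥-elim (j≢i refl)
readInput-zeroAt-≢ (_ ∷ _) {zero}  {suc _} _   = refl
readInput-zeroAt-≢ (_ ∷ _) {suc _} {zero}  _   = refl
readInput-zeroAt-≢ (_ ∷ x) {suc _} {suc _} j≢i = readInput-zeroAt-≢ x (j≢i ∘ cong suc)

readInput-zeroAt : ∀ x {i} → i < length x → readInput (zeroAt x i) i ≡ just false
readInput-zeroAt (_ ∷ _) {zero}  _           = refl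
readInput-zeroAt (_ ∷ x) {suc _} (s≤s i<∣x∣) = readInput-zeroAt x i<∣x∣

module _ (N : RATM) where
  open RATM N

  queried : List Bool → Config N → ℕ
  queried x C = addrValue ⌈log₂ length x ⌉ (Tape.cells (Config.addr C))

  succs-cong : ∀ x y C → length x ≡ length y →
    readInput x (queried x C) ≡ readInput y (queried x C) → succs N x C ≡ succs N y C
  succs-cong x y (config s _ _) ∣x∣≡∣y∣ same with kind s
  ... | accepting   = refl
  ... | rejecting   = refl
  ... | universal   rewrite sym ∣x∣≡∣y∣ | same = refl
  ... | existential rewrite sym ∣x∣≡∣y∣ | same = refl

module _ (N : RATM) (noExistential : ∀ s → RATM.kind N s ≢ existential) (x : List Bool) where

  succs-zeroAt : ∀ {i} C → queried N x C ≢ i → succs N (zeroAt x i) C ≡ succs N x C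
  succs-zeroAt {i} C q≢i =
    sym (succs-cong N x (zeroAt x i) C (sym (length-zeroAt x i)) (sym (readInput-zeroAt-≢ x q≢i)))

  ZeroingsAccepted : ℕ → Config N → Set
  ZeroingsAccepted t C =
    ∀ R → length R ≤ suc t → ∃[ i ] i ∉ R × Acc N (zeroAt x i) C

  ZeroingsAccepted-succs : ∀ {t C C′} → ZeroingsAccepted (suc t) C → C′ ∈ succs N x C →
                           ZeroingsAccepted t C′
  ZeroingsAccepted-succs {C = C} accepted C′∈ R ∣R∣≤t with accepted (queried N x C ∷ R) (s≤s ∣R∣≤t)
  ... | _ , _ , acc-final _ accept with () ← subst (_ ∈_) (succs-accepting N x C accept) C′∈
  ... | _ , _ , acc-exist _ exist _ = ⊥-elim (noExistential _ exist)
  ... | i , i∉ , acc-univ _ _ _ all =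
    i , i∉ ∘ there , All.lookup all (subst (_ ∈_) (sym (succs-zeroAt C (i∉ ∘ here ∘ sym))) C′∈)

  Acc-of-zeroings : ∀ t C → BoundedBy N x t C → ZeroingsAccepted t C → Acc N x C
  Acc-of-zeroings t C bounded accepted with accepted (queried N x C ∷ []) (s≤s z≤n)
  ... | _ , _  , acc-final _ accept   = acc-final C accept
  ... | _ , _  , acc-exist _ exist _  = ⊥-elim (noExistential _ exist)
  ... | i , i∉ , acc-univ _ isUniversal nonempty _ =
    acc-univ C isUniversal (nonempty ∘ trans sameSuccs) (successors t bounded accepted)
    where
    sameSuccs : succs N (zeroAt x i) C ≡ succs N x C
    sameSuccs = succs-zeroAt C (i∉ ∘ here ∘ sym)

    successors : ∀ t → BoundedBy N x t C → ZeroingsAccepted t C → All (Acc N x) (succs N x C)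
    successors zero    stuck   _        = ⊥-elim (nonempty (trans sameSuccs stuck))
    successors (suc t) bounded accepted = All.tabulate λ C′∈ →
      Acc-of-zeroings t _ (All.lookup bounded C′∈) (ZeroingsAccepted-succs accepted C′∈)

∈-─ : ∀ {s i : ℕ} R (s∈R : s ∈ R) → i ∈ R → i ≢ s → i ∈ R ─ s∈R
∈-─ (_ ∷ _) (here refl) (here refl) i≢s = ⊥-elim (i≢s refl)
∈-─ (_ ∷ _) (here refl) (there i∈R) _   = i∈R
∈-─ (_ ∷ R) (there s∈R) (here i≡a)  _   = here i≡a
∈-─ (_ ∷ R) (there s∈R) (there i∈R) i≢s = there (∈-─ R s∈R i∈R i≢s)

∃-∈-∉ : ∀ {S} R → Unique S → length R < length S → ∃[ i ] i ∈ S × i ∉ R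
∃-∈-∉ {s ∷ S} R (s≢S ∷ unique) ∣R∣<∣S∣ with s ∈? R
... | no s∉R = s , here refl , s∉R
... | yes s∈R with ∃-∈-∉ (R ─ s∈R) unique
                     (s<s⁻¹ (subst (_< suc (length S)) (length-removeAt′ R (index s∈R)) ∣R∣<∣S∣))
...   | i , i∈S , i∉R─s =
  i , there i∈S , λ i∈R → i∉R─s (∈-─ R s∈R i∈R (All.lookup s≢S i∈S ∘ sym))

<⇒<ᵇ≡true : ∀ {m n} → m < n → (m <ᵇ n) ≡ true
<⇒<ᵇ≡true {zero}  {suc _} _          = refl
<⇒<ᵇ≡true {suc m} {suc n} (s≤s m<n) = <⇒<ᵇ≡true m<n

n<ᵇn≡false : ∀ n → (n <ᵇ n) ≡ false
n<ᵇn≡false zero    = refl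
n<ᵇn≡false (suc n) = n<ᵇn≡false n

n≡ᵇn≡true : ∀ n → (n ≡ᵇ n) ≡ true
n≡ᵇn≡true zero    = refl
n≡ᵇn≡true (suc n) = n≡ᵇn≡true n

≢⇒≡ᵇ≡false : ∀ {m n} → m ≢ n → (m ≡ᵇ n) ≡ false
≢⇒≡ᵇ≡false {zero}  {zero}  m≢n = ⊥-elim (m≢n refl)
≢⇒≡ᵇ≡false {zero}  {suc _} _   = refl
≢⇒≡ᵇ≡false {suc _} {zero}  _   = refl
≢⇒≡ᵇ≡false {suc _} {suc _} m≢n = ≢⇒≡ᵇ≡false (m≢n ∘ cong suc)

module _ {A : Set} where

  writeAt-same : ∀ j (a : A) c → writeAt j a c j ≡ a
  writeAt-same j a c rewrite n≡ᵇn≡true j = refl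

  writeAt-other : ∀ {i} j (a : A) c → i ≢ j → writeAt j a c i ≡ c i
  writeAt-other j a c i≢j rewrite ≢⇒≡ᵇ≡false i≢j = refl

  writeAt-unchanged : ∀ j (a : A) c → c j ≡ a → ∀ i → writeAt j a c i ≡ c i
  writeAt-unchanged j a c cj≡a i with i ≟ j
  ... | yes refl = trans (writeAt-same i a c) (sym cj≡a)
  ... | no i≢j   = writeAt-other j a c i≢j

  writeAt-undo : ∀ j (a b : A) c → c j ≡ a → ∀ i → writeAt j a (writeAt j b c) i ≡ c i
  writeAt-undo j a b c cj≡a i with i ≟ j
  ... | yes refl = trans (writeAt-same i a (writeAt i b c)) (sym cj≡a)
  ... | no i≢j   = trans (writeAt-other j a (writeAt j b c) i≢j) (writeAt-other j b c i≢j)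

addrValue-cong : ∀ L {c c′} → (∀ i → i < L → c i ≡ c′ i) → addrValue L c ≡ addrValue L c′
addrValue-cong zero    _  = refl
addrValue-cong (suc L) c≗c′ =
  cong₂ (λ v b → v + bitVal b * 2 ^ L)
        (addrValue-cong L (λ i i<L → c≗c′ i (m≤n⇒m≤1+n i<L))) (c≗c′ L ≤-refl)

addrValue-blank : ∀ L → addrValue L (λ _ → false) ≡ 0
addrValue-blank zero    = refl
addrValue-blank (suc L) = cong (_+ 0) (addrValue-blank L)

addrValue-set : ∀ L c {j} → j < L → c j ≡ false →
  addrValue L (writeAt j true c) ≡ addrValue L c + 2 ^ j
addrValue-set (suc L) c {j} j<1+L cj≡false with j ≟ L
... | yes refl = begin
  addrValue j (writeAt j true c) + bitVal (writeAt j true c j) * 2 ^ j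
    ≡⟨ cong₂ (λ v b → v + bitVal b * 2 ^ j)
         (addrValue-cong j (λ i i<j → writeAt-other j true c (<⇒≢ i<j))) (writeAt-same j true c) ⟩
  addrValue j c + 1 * 2 ^ j
    ≡⟨ cong (λ b → addrValue j c + b) (+-identityʳ (2 ^ j)) ⟩
  addrValue j c + 2 ^ j
    ≡⟨ cong (λ b → b + 2 ^ j) (sym (+-identityʳ (addrValue j c))) ⟩
  addrValue j c + 0 + 2 ^ j
    ≡⟨ cong (λ b → addrValue j c + bitVal b * 2 ^ j + 2 ^ j) (sym cj≡false) ⟩
  addrValue j c + bitVal (c j) * 2 ^ j + 2 ^ j ∎
  where open ≡-Reasoning
... | no j≢L = begin
  addrValue L (writeAt j true c) + bitVal (writeAt j true c L) * 2 ^ L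
    ≡⟨ cong₂ (λ v b → v + bitVal b * 2 ^ L)
         (addrValue-set L c (≤∧≢⇒< (s≤s⁻¹ j<1+L) j≢L) cj≡false) (writeAt-other j true c (j≢L ∘ sym)) ⟩
  addrValue L c + 2 ^ j + bitVal (c L) * 2 ^ L
    ≡⟨ +-assoc (addrValue L c) _ _ ⟩
  addrValue L c + (2 ^ j + bitVal (c L) * 2 ^ L)
    ≡⟨ cong (addrValue L c +_) (+-comm (2 ^ j) _) ⟩
  addrValue L c + (bitVal (c L) * 2 ^ L + 2 ^ j)
    ≡⟨ sym (+-assoc (addrValue L c) _ _) ⟩
  addrValue L c + bitVal (c L) * 2 ^ L + 2 ^ j ∎
  where open ≡-Reasoning

readAddress : ℕ → (ℕ → Bool) → ℕ → Maybe Bool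
readAddress L c h = if h <ᵇ L then just (c h) else nothing

writeAddress : ℕ → ℕ → Bool → (ℕ → Bool) → ℕ → Bool
writeAddress L h b c = if h <ᵇ L then writeAt h b c else c

writeAddress-cong : ∀ L h b {c c′} → (∀ i → c i ≡ c′ i) →
  ∀ i → writeAddress L h b c i ≡ writeAddress L h b c′ i
writeAddress-cong L h b c≗c′ i with h <ᵇ L
... | false = c≗c′ i
... | true with i ≡ᵇ h
...   | true  = refl
...   | false = c≗c′ i

readAddress-< : ∀ {L h} c → h < L → readAddress L c h ≡ just (c h)
readAddress-< c h<L rewrite <⇒<ᵇ≡true h<L = refl

readAddress-end : ∀ L c → readAddress L c L ≡ nothing
readAddress-end L c rewrite n<ᵇn≡false L = refl

writeAddress-< : ∀ {L h} b c → h < L → ∀ i → writeAddress L h b c i ≡ writeAt h b c i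
writeAddress-< b c h<L i rewrite <⇒<ᵇ≡true h<L = refl

writeAddress-end : ∀ L b c i → writeAddress L L b c i ≡ c i
writeAddress-end L b c i rewrite n<ᵇn≡false L = refl

addrMoveHead-right : ∀ {L h} → h < L → addrMoveHead L right h ≡ suc h
addrMoveHead-right h<L rewrite <⇒<ᵇ≡true h<L = refl

moveHead-left : ∀ h → moveHead left h ≡ pred h
moveHead-left zero    = refl
moveHead-left (suc h) = refl

-- The enumerating machine

data Phase : Set where
  mark seekEnd probe found : Phase
  scanLeft seekRight       : ℕ → Phase

encode : Phase → ℕ
encode mark          = 0
encode seekEnd       = 1
encode probe         = 2
encode found         = 3
encode (scanLeft e)  = 4 + (e + e)
encode (seekRight e) = 5 + (e + e)

nextLevel : Phase → Phase
nextLevel (scanLeft e)  = scanLeft (suc e)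
nextLevel (seekRight e) = seekRight (suc e)
nextLevel p             = p

decodeLevel : ℕ → Phase
decodeLevel zero          = scanLeft 0
decodeLevel (suc zero)    = seekRight 0
decodeLevel (suc (suc n)) = nextLevel (decodeLevel n)

decode : ℕ → Phase
decode 0                         = mark
decode 1                         = seekEnd
decode 2                         = probe
decode 3                         = found
decode (suc (suc (suc (suc n)))) = decodeLevel n

decodeLevel-scanLeft : ∀ e → decodeLevel (e + e) ≡ scanLeft e
decodeLevel-scanLeft zero    = refl
decodeLevel-scanLeft (suc e) rewrite +-suc e e | decodeLevel-scanLeft e = refl

decodeLevel-seekRight : ∀ e → decodeLevel (suc (e + e)) ≡ seekRight e
decodeLevel-seekRight zero    = refl
decodeLevel-seekRight (suc e) rewrite +-suc e e | decodeLevel-seekRight e = refl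

decode-encode : ∀ p → decode (encode p) ≡ p
decode-encode mark          = refl
decode-encode seekEnd       = refl
decode-encode probe         = refl
decode-encode found         = refl
decode-encode (scanLeft e)  = decodeLevel-scanLeft e
decode-encode (seekRight e) = decodeLevel-seekRight e

phaseKind : Phase → Kind
phaseKind found = accepting
phaseKind _     = universal

phaseKind≢existential : ∀ p → phaseKind p ≢ existential
phaseKind≢existential mark          ()
phaseKind≢existential seekEnd       ()
phaseKind≢existential probe         ()
phaseKind≢existential found         ()
phaseKind≢existential (scanLeft _)  ()
phaseKind≢existential (seekRight _) ()

record Instr : Set where
  constructor instr
  field
    next  : Phase
    write : Bool
    move  : Move
open Instr

-- The machine writes a 1 into address cell 0, marking the left end the head cannot sense,
-- and runs to the right end of the address tape. In phase scanLeft e it sets the cell under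
-- the head and moves left to place e further bits; at e = 0 it probes the address, clears
-- the bit and moves on left. Meeting the marker in scanLeft e it turns to seekRight (suc e),
-- which moves right to the lowest set bit, clears it and resumes scanLeft (suc e) one cell
-- to its left; if there is no such bit it halts without accepting.
module Enumerator (k : ℕ) where

  maxCode : ℕ
  maxCode = 5 + (suc k + suc k)

  program : Phase → Maybe Bool → Maybe Bool → List Instr
  program mark               _            (just _)     = instr seekEnd true right ∷ []
  program mark               _            nothing      = []
  program seekEnd            _            (just b)     = instr seekEnd b right ∷ []
  program seekEnd            _            nothing      = instr (scanLeft k) false left ∷ []
  program (scanLeft e)       _            (just true)  = instr (seekRight (suc e)) true right ∷ []
  program (scanLeft zero)    _            (just false) = instr probe true stay ∷ []
  program (scanLeft (suc e)) _            (just false) = instr (scanLeft e) true left ∷ []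
  program (scanLeft _)       _            nothing      = []
  program probe              (just false) _            = instr found true stay ∷ []
  program probe              _            _            = instr (scanLeft 0) false left ∷ []
  program (seekRight e)      _            (just false) = instr (seekRight e) false right ∷ []
  program (seekRight e)      _            (just true)  = instr (scanLeft e) false left ∷ []
  program (seekRight _)      _            nothing      = []
  program found              _            _            = []

  state : Fin (suc maxCode) → Phase
  state s = decode (toℕ s)

  state-code : ∀ p → encode p ≤ maxCode → state (encode p mod suc maxCode) ≡ p
  state-code p p≤max =
    trans (cong decode (trans (toℕ-fromℕ< _) (m<n⇒m%n≡m (s≤s p≤max)))) (decode-encode p)

  toAction : Instr → Action (suc maxCode) 0 0
  toAction i = record
    { next      = encode (next i) mod suc maxCode
    ; workWrite = λ ()
    ; workMove  = λ ()
    ; addrWrite = write i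
    ; addrMove  = move i
    }

  M : RATM
  M = record
    { q     = suc maxCode
    ; g     = 0
    ; w     = 0
    ; start = Fin.zero
    ; kind  = λ s → phaseKind (state s)
    ; δ     = λ s input address _ → map toAction (program (state s) input address)
    }

  level≤⇒scanLeft≤maxCode : ∀ {e} → e ≤ suc k → encode (scanLeft e) ≤ maxCode
  level≤⇒scanLeft≤maxCode e≤ = +-mono-≤ (n≤1+n 4) (+-mono-≤ e≤ e≤)

  level≤⇒seekRight≤maxCode : ∀ {e} → e ≤ suc k → encode (seekRight e) ≤ maxCode
  level≤⇒seekRight≤maxCode e≤ = +-monoʳ-≤ 5 (+-mono-≤ e≤ e≤)

  record Matches (C : Config M) (p : Phase) (c : ℕ → Bool) (h : ℕ) : Set where
    constructor matches
    field
      phase : state (Config.state C) ≡ p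
      cells : ∀ i → Tape.cells (Config.addr C) i ≡ c i
      head  : Tape.head (Config.addr C) ≡ h

  Matches-cells : ∀ {C p c c′ h h′} → Matches C p c h → (∀ i → c i ≡ c′ i) → h ≡ h′ → Matches C p c′ h′
  Matches-cells (matches phase cells head) c≗c′ h≡h′ =
    matches phase (λ i → trans (cells i) (c≗c′ i)) (trans head h≡h′)

  kind-Matches : ∀ {C p c h} → Matches C p c h → RATM.kind M (Config.state C) ≡ phaseKind p
  kind-Matches (matches phase _ _) = cong phaseKind phase

-- The addresses probed by scanLeft e started at head position h with address value v.
probes : ℕ → ℕ → ℕ → List ℕ
probes _       zero    _ = []
probes zero    (suc p) v = v + 2 ^ suc p ∷ probes zero p v
probes (suc e) (suc p) v = probes e p (v + 2 ^ suc p) ++ probes (suc e) p v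

scanCost : ℕ → ℕ → ℕ
scanCost L zero    = 2
scanCost L (suc e) = L * scanCost L e + L + 3

scanCost-step : ∀ {p L} a b → p ≤ L → suc (p * a + (suc (suc p) + b)) ≤ (L * a + L + 3) + b
scanCost-step {p} {L} a b p≤L = begin
  suc (p * a + (suc (suc p) + b)) ≡⟨ rearrange ⟩
  p * a + p + 3 + b                ≤⟨ +-monoˡ-≤ b (+-monoˡ-≤ 3 (+-mono-≤ (*-monoˡ-≤ a p≤L) p≤L)) ⟩
  L * a + L + 3 + b                ∎
  where
  open ≤-Reasoning
  rearrange : suc (p * a + (suc (suc p) + b)) ≡ p * a + p + 3 + b
  rearrange = solve 3 (λ p a b → con 1 :+ (p :* a :+ (con 2 :+ p :+ b)) := p :* a :+ p :+ con 3 :+ b) refl p a b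
    where open +-*-Solver

runTime : ℕ → ℕ → ℕ → ℕ
runTime k L L′ = 1 + (suc L′ + (L′ * scanCost L k + (1 + L′)))

module Execution (k : ℕ) (x : List Bool) where
  open Enumerator k

  L : ℕ
  L = ⌈log₂ length x ⌉

  Universal : Config M → Set
  Universal C = RATM.kind M (Config.state C) ≡ universal

  instructions : Config M → List Instr
  instructions (config s _ ad) =
    program (state s) (readInput x (addrValue L (Tape.cells ad))) (readAddr L ad)

  succs-universal : ∀ C → Universal C →
    succs M x C ≡ map (λ a → apply M L a C) (map toAction (instructions C))
  succs-universal (config s _ _) univ with phaseKind (state s) | univ
  ... | .universal | refl = refl

  programAt : Phase → (ℕ → Bool) → ℕ → List Instr
  programAt p c h = program p (readInput x (addrValue L c)) (readAddress L c h)

  instructions-Matches : ∀ {C p c h} → Matches C p c h → instructions C ≡ programAt p c h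
  instructions-Matches {config s _ (tape _ h)} (matches refl cells refl) =
    cong₂ (λ v b → program (state s) (readInput x v) (if h <ᵇ L then just b else nothing))
          (addrValue-cong L (λ i _ → cells i)) (cells h)

  data Reaches (P : Config M → Set) : ℕ → Config M → Set where
    done : ∀ {t C} → P C → Reaches P t C
    step : ∀ {t C C′} → Universal C → succs M x C ≡ C′ ∷ [] → Reaches P t C′ → Reaches P (suc t) C

  Reaches-mono : ∀ {P t t′ C} → t ≤ t′ → Reaches P t C → Reaches P t′ C
  Reaches-mono _         (done p)              = done p
  Reaches-mono (s≤s t≤t′) (step univ succs≡ r) = step univ succs≡ (Reaches-mono t≤t′ r)

  Reaches-map : ∀ {P R : Config M → Set} {t C} → (∀ {C′} → P C′ → R C′) → Reaches P t C → Reaches R t C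
  Reaches-map f (done p)              = done (f p)
  Reaches-map f (step univ succs≡ r) = step univ succs≡ (Reaches-map f r)

  Reaches-trans : ∀ {P R : Config M → Set} {t u C} →
    Reaches P t C → (∀ {C′} → P C′ → Reaches R u C′) → Reaches R (t + u) C
  Reaches-trans {t = t} {u} (done p)         f = Reaches-mono (m≤n+m u t) (f p)
  Reaches-trans (step univ succs≡ r) f = step univ succs≡ (Reaches-trans r f)

  Reaches⇒BoundedBy : ∀ {P t C} → Reaches P t C → (∀ C′ → P C′ → succs M x C′ ≡ []) → BoundedBy M x t C
  Reaches⇒BoundedBy {C = C} (done p) halts = BoundedBy-mono M x C z≤n (halts C p)
  Reaches⇒BoundedBy (step _ succs≡ r) halts rewrite succs≡ = Reaches⇒BoundedBy r halts ∷ []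

  Reaches-Acc : ∀ {P t C} → Reaches P t C → (∀ {C′} → P C′ → Acc M x C′) → Acc M x C
  Reaches-Acc (done p)                      accepts = accepts p
  Reaches-Acc {C = C} (step univ succs≡ r) accepts =
    acc-univ C univ (λ succs≡[] → case trans (sym succs≡) succs≡[] of λ ())
             (subst (All (Acc M x)) (sym succs≡) (Reaches-Acc r accepts ∷ []))

  Reaches-¬Acc : ∀ {P t C} → Reaches P t C → (∀ {C′} → P C′ → ¬ Acc M x C′) → ¬ Acc M x C
  Reaches-¬Acc (done p) rejects = rejects p
  Reaches-¬Acc (step univ _ _) _ (acc-final _ accept)  with () ← trans (sym univ) accept
  Reaches-¬Acc (step univ _ _) _ (acc-exist _ exist _) with () ← trans (sym univ) exist
  Reaches-¬Acc (step _ succs≡ r) rejects (acc-univ _ _ _ all) with subst (All (Acc M x)) succs≡ all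
  ... | accepted ∷ [] = Reaches-¬Acc r rejects accepted

  succs-Matches : ∀ {C p c h} → Matches C p c h → phaseKind p ≡ universal →
    succs M x C ≡ map (λ a → apply M L a C) (map toAction (programAt p c h))
  succs-Matches {C} m univ =
    trans (succs-universal C (trans (kind-Matches m) univ))
          (cong (λ is → map (λ a → apply M L a C) (map toAction is)) (instructions-Matches m))

  Reaches-step : ∀ {P t C p c h} i c′ h′ → Matches C p c h → phaseKind p ≡ universal →
    programAt p c h ≡ i ∷ [] → encode (next i) ≤ maxCode →
    (∀ j → writeAddress L h (write i) c j ≡ c′ j) → addrMoveHead L (move i) h ≡ h′ →
    (∀ {C′} → Matches C′ (next i) c′ h′ → Reaches P t C′) → Reaches P (suc t) C
  Reaches-step {C = config _ _ (tape _ h)} i c′ h′ m@(matches _ cells refl) univ prog code≤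
               written moved continue =
    step (trans (kind-Matches m) univ) (trans (succs-Matches m univ) (cong (map _ ∘ map toAction) prog))
      (continue (matches (state-code (next i) code≤)
                         (λ j → trans (writeAddress-cong L h (write i) cells j) (written j)) moved))

  Stuck : Config M → Set
  Stuck C = (succs M x C ≡ []) × Universal C

  Stuck-Matches : ∀ {C p c h} → Matches C p c h → phaseKind p ≡ universal →
    programAt p c h ≡ [] → Stuck C
  Stuck-Matches m univ prog =
    trans (succs-Matches m univ) (cong (map _ ∘ map toAction) prog) , trans (kind-Matches m) univ

  Stuck-¬Acc : ∀ {C} → Stuck C → ¬ Acc M x C
  Stuck-¬Acc (_ , univ) (acc-final _ accept) with () ← trans (sym univ) accept
  Stuck-¬Acc (_ , univ) (acc-exist _ exist _) with () ← trans (sym univ) exist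
  Stuck-¬Acc (stuck , _) (acc-univ _ _ nonempty _) = nonempty stuck

  seekRight-run : ∀ {e r c C} d i → i + d ≡ r → r < L → (∀ j → i ≤ j → j < r → c j ≡ false) →
    c r ≡ true → e ≤ suc k → Matches C (seekRight e) c i →
    Reaches (λ C′ → Matches C′ (scanLeft e) (writeAt r false c) (pred r)) (suc d) C
  seekRight-run {e} {c = c} zero i i+0≡r r<L _ cr≡true e≤ m with trans (sym (+-identityʳ i)) i+0≡r
  ... | refl =
    Reaches-step (instr (scanLeft e) false left) (writeAt i false c) (pred i) m refl
      (cong (program (seekRight e) _) (trans (readAddress-< c r<L) (cong just cr≡true)))
      (level≤⇒scanLeft≤maxCode e≤) (writeAddress-< false c r<L) (moveHead-left i) done
  seekRight-run {e} {r} {c} (suc d) i i+d≡r r<L zeros cr≡true e≤ m =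
    Reaches-step (instr (seekRight e) false right) c (suc i) m refl
      (cong (program (seekRight e) _) (trans (readAddress-< c i<L) (cong just ci≡false)))
      (level≤⇒seekRight≤maxCode e≤)
      (λ j → trans (writeAddress-< false c i<L j) (writeAt-unchanged i false c ci≡false j))
      (addrMoveHead-right i<L)
      (seekRight-run d (suc i) (trans (sym (+-suc i d)) i+d≡r) r<L
         (λ j i<j j<r → zeros j (<⇒≤ i<j) j<r) cr≡true e≤)
    where
    i<r : i < r
    i<r = subst (i <_) i+d≡r (m<m+n i z<s)
    i<L : i < L
    i<L = <-trans i<r r<L
    ci≡false : c i ≡ false
    ci≡false = zeros i ≤-refl i<r

  seekRight-exhausted : ∀ {e c C} d i → i + d ≡ L → (∀ j → i ≤ j → j < L → c j ≡ false) →
    e ≤ suc k → Matches C (seekRight e) c i → Reaches Stuck d C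
  seekRight-exhausted {e} {c} zero i i+0≡L _ _ m with trans (sym (+-identityʳ i)) i+0≡L
  ... | refl = done (Stuck-Matches m refl (cong (program (seekRight e) _) (readAddress-end L c)))
  seekRight-exhausted {e} {c} (suc d) i i+d≡L zeros e≤ m =
    Reaches-step (instr (seekRight e) false right) c (suc i) m refl
      (cong (program (seekRight e) _) (trans (readAddress-< c i<L) (cong just ci≡false)))
      (level≤⇒seekRight≤maxCode e≤)
      (λ j → trans (writeAddress-< false c i<L j) (writeAt-unchanged i false c ci≡false j))
      (addrMoveHead-right i<L)
      (seekRight-exhausted d (suc i) (trans (sym (+-suc i d)) i+d≡L) (λ j i<j j<L → zeros j (<⇒≤ i<j) j<L) e≤)
    where
    i<L : i < L
    i<L = subst (i <_) i+d≡L (m<m+n i z<s)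
    ci≡false : c i ≡ false
    ci≡false = zeros i ≤-refl i<L

  seekEnd-run : ∀ {c C} d i → i + d ≡ L → Matches C seekEnd c i →
    Reaches (λ C′ → Matches C′ (scanLeft k) c (pred L)) (suc d) C
  seekEnd-run {c} zero i i+0≡L m with trans (sym (+-identityʳ i)) i+0≡L
  ... | refl =
    Reaches-step (instr (scanLeft k) false left) c (pred i) m refl
      (cong (program seekEnd _) (readAddress-end L c)) (level≤⇒scanLeft≤maxCode (n≤1+n k))
      (writeAddress-end L false c) (moveHead-left i) done
  seekEnd-run {c} (suc d) i i+d≡L m =
    Reaches-step (instr seekEnd (c i) right) c (suc i) m refl
      (cong (program seekEnd _) (readAddress-< c i<L)) (s≤s z≤n)
      (λ j → trans (writeAddress-< (c i) c i<L j) (writeAt-unchanged i (c i) c refl j))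
      (addrMoveHead-right i<L) (seekEnd-run d (suc i) (trans (sym (+-suc i d)) i+d≡L))
    where
    i<L : i < L
    i<L = subst (i <_) i+d≡L (m<m+n i z<s)

  Zero : ℕ → Set
  Zero r = readInput x r ≡ just false

  Accepting : Config M → Set
  Accepting C = RATM.kind M (Config.state C) ≡ accepting

  ScanOutcome : ℕ → (ℕ → Bool) → ℕ → ℕ → Config M → Set
  ScanOutcome e c v h C =
    (Matches C (scanLeft e) c 0 × All (λ r → ¬ Zero r) (probes e h v)) ⊎ (Accepting C × Any Zero (probes e h v))

  scanLeft₀-run : ∀ h {c v C} → h < L → c 0 ≡ true → (∀ i → 1 ≤ i → i ≤ h → c i ≡ false) →
    addrValue L c ≡ v → Matches C (scanLeft 0) c h → Reaches (ScanOutcome 0 c v h) (h * scanCost L 0) C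
  scanLeft₀-run zero _ _ _ _ m = done (inj₁ (m , []))
  scanLeft₀-run (suc p) {c} {v} h<L c0≡true zeros av≡v m =
    Reaches-step (instr probe true stay) c₁ (suc p) m refl
      (cong (program (scanLeft 0) _) (trans (readAddress-< c h<L) (cong just ch≡false)))
      (s≤s (s≤s z≤n)) (writeAddress-< true c h<L) refl probe-run
    where
    ch≡false : c (suc p) ≡ false
    ch≡false = zeros (suc p) (s≤s z≤n) ≤-refl
    c₁ : ℕ → Bool
    c₁ = writeAt (suc p) true c
    av₁ : addrValue L c₁ ≡ v + 2 ^ suc p
    av₁ = trans (addrValue-set L c h<L ch≡false) (cong (_+ 2 ^ suc p) av≡v)

    moveOn : ∀ {C₁} b → b ≢ just false → readInput x (v + 2 ^ suc p) ≡ b →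
      program probe b (readAddress L c₁ (suc p)) ≡ instr (scanLeft 0) false left ∷ [] →
      Matches C₁ probe c₁ (suc p) → Reaches (ScanOutcome 0 c v (suc p)) (suc (p * 2)) C₁
    moveOn b b≢ input≡ prog m₁ =
      Reaches-step (instr (scanLeft 0) false left) c p m₁ refl
        (trans (cong (λ b → program probe b (readAddress L c₁ (suc p))) (trans (cong (readInput x) av₁) input≡))
               prog)
        (level≤⇒scanLeft≤maxCode z≤n)
        (λ i → trans (writeAddress-< false c₁ h<L i) (writeAt-undo (suc p) false true c ch≡false i)) refl
        (λ m₂ → Reaches-map extend
           (scanLeft₀-run p (<-trans (n<1+n p) h<L) c0≡true
              (λ i 1≤i i≤p → zeros i 1≤i (m≤n⇒m≤1+n i≤p)) av≡v m₂))
      where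
      extend : ∀ {C′} → ScanOutcome 0 c v p C′ → ScanOutcome 0 c v (suc p) C′
      extend (inj₁ (m′ , nonzero)) = inj₁ (m′ , b≢ ∘ trans (sym input≡) ∷ nonzero)
      extend (inj₂ (accept , zero∈)) = inj₂ (accept , there zero∈)

    probe-run : ∀ {C₁} → Matches C₁ probe c₁ (suc p) → Reaches (ScanOutcome 0 c v (suc p)) (suc (p * 2)) C₁
    probe-run m₁ with readInput x (v + 2 ^ suc p) in input≡
    ... | just false =
      Reaches-step (instr found true stay) (writeAddress L (suc p) true c₁) (suc p) m₁ refl
        (cong (λ b → program probe b (readAddress L c₁ (suc p))) (trans (cong (readInput x) av₁) input≡))
        (s≤s (s≤s (s≤s z≤n)))
        (λ _ → refl) refl (λ m₂ → done (inj₂ (kind-Matches m₂ , here input≡)))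
    ... | just true = moveOn (just true) (λ ()) input≡ refl m₁
    ... | nothing   = moveOn nothing (λ ()) input≡ refl m₁

  scanLeft-run : ∀ e h {c v C} → e ≤ k → h < L → c 0 ≡ true → (∀ i → 1 ≤ i → i ≤ h → c i ≡ false) →
    addrValue L c ≡ v → Matches C (scanLeft e) c h → Reaches (ScanOutcome e c v h) (h * scanCost L e) C
  scanLeft-run e       zero    _ _ _ _ _ m = done (inj₁ (m , []))
  scanLeft-run zero    (suc p) _ = scanLeft₀-run (suc p)
  scanLeft-run (suc e) (suc p) {c} {v} e<k h<L c0≡true zeros av≡v m =
    Reaches-mono (scanCost-step (scanCost L e) (p * scanCost L (suc e)) (≤-trans (n≤1+n p) (<⇒≤ h<L)))
      (Reaches-step (instr (scanLeft e) true left) c₁ p m refl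
        (cong (program (scanLeft (suc e)) _) (trans (readAddress-< c h<L) (cong just ch≡false)))
        (level≤⇒scanLeft≤maxCode (≤-trans e≤k (n≤1+n k))) (writeAddress-< true c h<L) refl
        (λ m₁ → Reaches-trans (scanLeft-run e p e≤k p<L c₁0≡true zeros₁ av₁ m₁) continue))
    where
    ch≡false : c (suc p) ≡ false
    ch≡false = zeros (suc p) (s≤s z≤n) ≤-refl
    c₁ : ℕ → Bool
    c₁ = writeAt (suc p) true c
    v₁ : ℕ
    v₁ = v + 2 ^ suc p
    e≤k : e ≤ k
    e≤k = ≤-trans (n≤1+n e) e<k
    p<L : p < L
    p<L = <-trans (n<1+n p) h<L
    0<L : 0 < L
    0<L = ≤-trans (s≤s z≤n) h<L
    c₁0≡true : c₁ 0 ≡ true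
    c₁0≡true = trans (writeAt-other (suc p) true c (λ ())) c0≡true
    zeros₁ : ∀ i → 1 ≤ i → i ≤ p → c₁ i ≡ false
    zeros₁ i 1≤i i≤p = trans (writeAt-other (suc p) true c (<⇒≢ (s≤s i≤p))) (zeros i 1≤i (m≤n⇒m≤1+n i≤p))
    av₁ : addrValue L c₁ ≡ v₁
    av₁ = trans (addrValue-set L c h<L ch≡false) (cong (_+ 2 ^ suc p) av≡v)

    continue : ∀ {C′} → ScanOutcome e c₁ v₁ p C′ →
      Reaches (ScanOutcome (suc e) c v (suc p)) (suc (suc p) + p * scanCost L (suc e)) C′
    continue (inj₂ (accept , zero∈)) = done (inj₂ (accept , Any.++⁺ˡ zero∈))
    continue (inj₁ (m′ , nonzero₁)) =
      Reaches-step (instr (seekRight (suc e)) true right) c₁ 1 m′ refl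
        (cong (program (scanLeft e) _) (trans (readAddress-< c₁ 0<L) (cong just c₁0≡true)))
        (level≤⇒seekRight≤maxCode (m≤n⇒m≤1+n e<k))
        (λ i → trans (writeAddress-< true c₁ 0<L i) (writeAt-unchanged 0 true c₁ c₁0≡true i))
        (addrMoveHead-right 0<L)
        (λ m₂ → Reaches-trans
          (seekRight-run p 1 refl h<L
             (λ j 1≤j j<h → trans (writeAt-other (suc p) true c (<⇒≢ j<h)) (zeros j 1≤j (<⇒≤ j<h)))
             (writeAt-same (suc p) true c) (m≤n⇒m≤1+n e<k) m₂)
          (λ m₃ → Reaches-map extend
             (scanLeft-run (suc e) p e<k p<L c0≡true (λ i 1≤i i≤p → zeros i 1≤i (m≤n⇒m≤1+n i≤p)) av≡v
                (Matches-cells m₃ (writeAt-undo (suc p) false true c ch≡false) refl))))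
      where
      extend : ∀ {C′} → ScanOutcome (suc e) c v p C′ → ScanOutcome (suc e) c v (suc p) C′
      extend (inj₁ (m′ , nonzero)) = inj₁ (m′ , All.++⁺ nonzero₁ nonzero)
      extend (inj₂ (accept , zero∈)) = inj₂ (accept , Any.++⁺ʳ _ zero∈)

  Outcome : List ℕ → Config M → Set
  Outcome R C = (Stuck C × All (λ r → ¬ Zero r) R) ⊎ (Accepting C × Any Zero R)

  run : ∀ L′ → L ≡ suc L′ → Reaches (Outcome (probes k L′ 1)) (runTime k L L′) (initial M)
  run L′ L≡ =
    Reaches-step (instr seekEnd true right) c₀ 1 (matches refl (λ _ → refl) refl) refl
      (cong (program mark _) (readAddress-< (λ _ → false) 0<L)) (s≤s z≤n)
      (writeAddress-< true (λ _ → false) 0<L) (addrMoveHead-right 0<L)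
      (λ m₁ → Reaches-trans (seekEnd-run L′ 1 (sym L≡) m₁)
        (λ m₂ → Reaches-trans
          (scanLeft-run k L′ ≤-refl L′<L refl (λ { (suc _) _ _ → refl }) av₀
             (Matches-cells m₂ (λ _ → refl) (cong pred L≡)))
          finish))
    where
    0<L : 0 < L
    0<L = subst (0 <_) (sym L≡) z<s
    L′<L : L′ < L
    L′<L = subst (L′ <_) (sym L≡) ≤-refl
    c₀ : ℕ → Bool
    c₀ = writeAt 0 true (λ _ → false)
    av₀ : addrValue L c₀ ≡ 1
    av₀ = trans (addrValue-set L (λ _ → false) 0<L refl) (cong (_+ 1) (addrValue-blank L))

    finish : ∀ {C′} → ScanOutcome k c₀ 1 L′ C′ → Reaches (Outcome (probes k L′ 1)) (1 + L′) C′
    finish (inj₂ accepted) = done (inj₂ accepted)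
    finish (inj₁ (m′ , nonzero)) =
      Reaches-step (instr (seekRight (suc k)) true right) c₀ 1 m′ refl
        (cong (program (scanLeft k) _) (readAddress-< c₀ 0<L)) (level≤⇒seekRight≤maxCode ≤-refl)
        (λ i → trans (writeAddress-< true c₀ 0<L i) (writeAt-unchanged 0 true c₀ refl i)) (addrMoveHead-right 0<L)
        (λ m₄ → Reaches-map (λ stuck → inj₁ (stuck , nonzero))
          (seekRight-exhausted L′ 1 (sym L≡) (λ { (suc _) _ _ → refl }) ≤-refl m₄))

  run-empty : L ≡ 0 → Reaches (Outcome []) 0 (initial M)
  run-empty L≡0 = done (inj₁ (Stuck-Matches {initial M} (matches refl (λ _ → refl) refl) refl
    (cong (program mark _) (subst (λ L → readAddress L (λ _ → false) 0 ≡ nothing) (sym L≡0) refl)) , []))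

  Outcome-halts : ∀ {R} C → Outcome R C → succs M x C ≡ []
  Outcome-halts _ (inj₁ ((stuck , _) , _)) = stuck
  Outcome-halts C (inj₂ (accept , _))       = succs-accepting M x C accept

  Outcome-Acc : ∀ {R C i} → i ∈ R → Zero i → Outcome R C → Acc M x C
  Outcome-Acc i∈R isZero (inj₁ (_ , nonzero)) = ⊥-elim (All.lookup nonzero i∈R isZero)
  Outcome-Acc {C = C} _ _ (inj₂ (accept , _)) = acc-final C accept

  Outcome-¬Acc : ∀ {R C} → (∀ r → ¬ Zero r) → Outcome R C → ¬ Acc M x C
  Outcome-¬Acc _        (inj₁ (stuck , _))  = Stuck-¬Acc stuck
  Outcome-¬Acc nonzero (inj₂ (_ , zero∈)) _ = nonzero _ (proj₂ (Any.satisfied zero∈))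

-- Counting the probed addresses

probeCount : ℕ → ℕ → ℕ
probeCount _       zero    = 0
probeCount zero    (suc p) = suc (probeCount zero p)
probeCount (suc e) (suc p) = probeCount e p + probeCount (suc e) p

length-probes : ∀ e h v → length (probes e h v) ≡ probeCount e h
length-probes _       zero    _ = refl
length-probes zero    (suc p) v = cong suc (length-probes zero p v)
length-probes (suc e) (suc p) v =
  trans (length-++ (probes e p (v + 2 ^ suc p))) (cong₂ _+_ (length-probes e p _) (length-probes (suc e) p v))

probeCount-zero : ∀ h → probeCount zero h ≡ h
probeCount-zero zero    = refl
probeCount-zero (suc h) = cong suc (probeCount-zero h)

probeCount-≤-suc : ∀ e h → probeCount e h ≤ probeCount e (suc h)
probeCount-≤-suc zero    h       = n≤1+n _
probeCount-≤-suc (suc e) zero    = z≤n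
probeCount-≤-suc (suc e) (suc h) = m≤n+m (probeCount (suc e) (suc h)) (probeCount e (suc h))

probeCount-≤-+ : ∀ e h j → probeCount e h ≤ probeCount e (h + j)
probeCount-≤-+ e h zero    = ≤-reflexive (cong (probeCount e) (sym (+-identityʳ h)))
probeCount-≤-+ e h (suc j) =
  ≤-trans (probeCount-≤-+ e h j)
          (≤-trans (probeCount-≤-suc e (h + j)) (≤-reflexive (cong (probeCount e) (sym (+-suc h j)))))

*-probeCount≤ : ∀ e h j → j * probeCount e h ≤ probeCount (suc e) (h + j)
*-probeCount≤ e h zero    = z≤n
*-probeCount≤ e h (suc j) rewrite +-suc h j = +-mono-≤ (probeCount-≤-+ e h j) (*-probeCount≤ e h j)

^≤probeCount : ∀ e m → m ^ suc e ≤ probeCount e (suc e * m)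
^≤probeCount zero    m rewrite +-identityʳ m | probeCount-zero m | *-identityʳ m = ≤-refl
^≤probeCount (suc e) m = begin
  m * m ^ suc e                  ≤⟨ *-monoʳ-≤ m (^≤probeCount e m) ⟩
  m * probeCount e (suc e * m)   ≤⟨ *-probeCount≤ e (suc e * m) m ⟩
  probeCount (suc e) (suc e * m + m) ≡⟨ cong (probeCount (suc e)) (+-comm (suc e * m) m) ⟩
  probeCount (suc e) (suc (suc e) * m) ∎
  where open ≤-Reasoning

InWindow : ℕ → ℕ → ℕ → Set
InWindow v h r = v < r × r + 2 ≤ v + 2 ^ suc h

InWindow-widen : ∀ {v h r} → InWindow v h r → InWindow v (suc h) r
InWindow-widen {v} {h} (v<r , r+2≤) = v<r , ≤-trans r+2≤ (+-monoʳ-≤ v (^-monoʳ-≤ 2 (n≤1+n (suc h))))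

2^suc+2^suc : ∀ p → 2 ^ suc p + 2 ^ suc p ≡ 2 ^ suc (suc p)
2^suc+2^suc p = cong (2 ^ suc p +_) (sym (+-identityʳ (2 ^ suc p)))

probes-inWindow : ∀ e h v → All (InWindow v h) (probes e h v)
probes-inWindow _ zero _ = []
probes-inWindow zero (suc p) v =
  (v<v+2^ , v+2^+2≤) ∷ All.map (InWindow-widen {h = p}) (probes-inWindow zero p v)
  where
  v<v+2^ : v < v + 2 ^ suc p
  v<v+2^ = m<m+n v (m^n>0 2 (suc p))
  v+2^+2≤ : v + 2 ^ suc p + 2 ≤ v + 2 ^ suc (suc p)
  v+2^+2≤ = begin
    v + 2 ^ suc p + 2               ≡⟨ +-assoc v _ 2 ⟩
    v + (2 ^ suc p + 2)             ≤⟨ +-monoʳ-≤ v (+-monoʳ-≤ (2 ^ suc p) (*-monoʳ-≤ 2 (m^n>0 2 p))) ⟩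
    v + (2 ^ suc p + 2 ^ suc p)     ≡⟨ cong (v +_) (2^suc+2^suc p) ⟩
    v + 2 ^ suc (suc p)             ∎
    where open ≤-Reasoning
probes-inWindow (suc e) (suc p) v =
  All.++⁺ (All.map upper (probes-inWindow e p (v + 2 ^ suc p)))
          (All.map (InWindow-widen {h = p}) (probes-inWindow (suc e) p v))
  where
  upper : ∀ {r} → InWindow (v + 2 ^ suc p) p r → InWindow v (suc p) r
  upper (v′<r , r+2≤) =
    <-≤-trans (m<m+n v (m^n>0 2 (suc p))) (<⇒≤ v′<r) ,
    ≤-trans r+2≤ (≤-reflexive (trans (+-assoc v _ _) (cong (v +_) (2^suc+2^suc p))))

probes-descending : ∀ e h v → AllPairs _>_ (probes e h v)
probes-descending _ zero _ = []
probes-descending zero (suc p) v =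
  All.map (λ (_ , r+2≤) → <-≤-trans (m<m+n _ z<s) r+2≤) (probes-inWindow zero p v) ∷ probes-descending zero p v
probes-descending (suc e) (suc p) v =
  AllPairs.++⁺ (probes-descending e p _) (probes-descending (suc e) p v)
    (All.map (λ (v′<r , _) → All.map (λ (_ , r′+2≤) → <-trans (<-≤-trans (m<m+n _ z<s) r′+2≤) v′<r)
                                      (probes-inWindow (suc e) p v))
             (probes-inWindow e p (v + 2 ^ suc p)))

probes-unique : ∀ e h v → Unique (probes e h v)
probes-unique e h v = AllPairs.map >⇒≢ (probes-descending e h v)

m≤m^suc : ∀ m e → suc m ≤ suc m ^ suc e
m≤m^suc m e = m≤m*n (suc m) (suc m ^ e) {{m^n≢0 (suc m) e}}

scanCost-bound : ∀ L′ e → scanCost (suc L′) e ≤ 8 ^ suc e * suc L′ ^ e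
scanCost-bound L′ zero    = s≤s (s≤s z≤n)
scanCost-bound L′ (suc e) = begin
  L * scanCost L e + L + 3  ≡⟨ +-assoc (L * scanCost L e) L 3 ⟩
  L * scanCost L e + (L + 3) ≤⟨ +-mono-≤ (*-monoʳ-≤ L (scanCost-bound L′ e)) L+3≤ ⟩
  L * (A * L ^ e) + 7 * (A * P) ≡⟨ cong (_+ 7 * (A * P)) (x∙yz≈y∙xz L A (L ^ e)) ⟩
  A * P + 7 * (A * P)       ≡⟨ sym (*-assoc 8 A P) ⟩
  8 * A * P                 ∎
  where
  open ≤-Reasoning
  L = suc L′
  A = 8 ^ suc e
  P = L ^ suc e
  L+3≤ : L + 3 ≤ 7 * (A * P)
  L+3≤ = begin
    L + 3     ≤⟨ +-monoʳ-≤ L (m≤m*n 3 L) ⟩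
    4 * L     ≤⟨ *-monoʳ-≤ 4 (m≤m^suc L′ e) ⟩
    4 * P     ≤⟨ *-monoˡ-≤ P (m≤m+n 4 3) ⟩
    7 * P     ≤⟨ *-monoʳ-≤ 7 (m≤n*m P A {{m^n≢0 8 (suc e)}}) ⟩
    7 * (A * P) ∎

runTime-bound : ∀ k L′ → runTime k (suc L′) L′ ≤ (8 ^ suc k + 3) * (suc L′ ^ suc k + 1)
runTime-bound k L′ = begin
  runTime k L L′               ≡⟨ rearrange ⟩
  L′ * scanCost L k + (L + (L + 1)) ≤⟨ +-mono-≤ (*-monoˡ-≤ (scanCost L k) (n≤1+n L′))
                                              (+-monoʳ-≤ L (+-monoʳ-≤ L (s≤s z≤n))) ⟩
  L * scanCost L k + 3 * L      ≤⟨ +-mono-≤ (*-monoʳ-≤ L (scanCost-bound L′ k)) (*-monoʳ-≤ 3 (m≤m^suc L′ k)) ⟩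
  L * (A * L ^ k) + 3 * P       ≡⟨ cong (_+ 3 * P) (x∙yz≈y∙xz L A (L ^ k)) ⟩
  A * P + 3 * P                 ≡⟨ sym (*-distribʳ-+ P A 3) ⟩
  (A + 3) * P                   ≤⟨ *-monoʳ-≤ (A + 3) (m≤m+n P 1) ⟩
  (A + 3) * (P + 1)             ∎
  where
  open ≤-Reasoning
  L = suc L′
  A = 8 ^ suc k
  P = L ^ suc k
  rearrange : runTime k L L′ ≡ L′ * scanCost L k + (L + (L + 1))
  rearrange = solve 2 (λ l s → con 1 :+ (con 1 :+ l :+ (l :* s :+ (con 1 :+ l))) :=
                               l :* s :+ ((con 1 :+ l) :+ ((con 1 :+ l) :+ con 1))) refl L′ (scanCost L k)
    where open +-*-Solver

^-distribʳ-* : ∀ a b e → (a * b) ^ e ≡ a ^ e * b ^ e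
^-distribʳ-* a b zero    = refl
^-distribʳ-* a b (suc e) rewrite ^-distribʳ-* a b e =
  solve 4 (λ a b A B → (a :* b) :* (A :* B) := (a :* A) :* (b :* B)) refl a b (a ^ e) (b ^ e)
  where open +-*-Solver

blockSize : ℕ → ℕ → ℕ
blockSize c k = c * (2 + k) ^ k + c + 2

-- L = 1 + (k + 1) m ≤ (k + 2) m, so c L^k ≤ c (k + 2)^k m^k, which m^(k+1) beats by at least c + 2.
budget<blockSize^ : ∀ c k → 2 + c * (suc (suc k * blockSize c k) ^ k + 1) ≤ blockSize c k ^ suc k
budget<blockSize^ c k = begin
  2 + c * (L ^ k + 1)              ≡⟨ cong (2 +_) (*-distribˡ-+ c (L ^ k) 1) ⟩
  2 + (c * L ^ k + c * 1)          ≤⟨ +-monoʳ-≤ 2 (+-mono-≤ (*-monoʳ-≤ c L^k≤) (≤-reflexive (*-identityʳ c))) ⟩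
  2 + (c * ((2 + k) ^ k * P) + c)  ≡⟨ rearrange ⟩
  B * P + (c + 2)                  ≤⟨ +-monoʳ-≤ (B * P) (m≤m*n (c + 2) P {{m^n≢0 m k {{m≢0}}}}) ⟩
  B * P + (c + 2) * P              ≡⟨ sym (*-distribʳ-+ P B (c + 2)) ⟩
  (B + (c + 2)) * P                ≡⟨ cong (_* P) (sym (+-assoc B c 2)) ⟩
  m * P                            ∎
  where
  open ≤-Reasoning
  m = blockSize c k
  L = suc (suc k * m)
  P = m ^ k
  B = c * (2 + k) ^ k
  1≤m : 1 ≤ m
  1≤m = ≤-trans (s≤s z≤n) (m≤n+m 2 (B + c))
  m≢0 : NonZero m
  m≢0 = >-nonZero 1≤m
  L^k≤ : L ^ k ≤ (2 + k) ^ k * P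
  L^k≤ = ≤-trans (^-monoˡ-≤ k (+-monoˡ-≤ (suc k * m) 1≤m)) (≤-reflexive (^-distribʳ-* (2 + k) m k))
  rearrange : 2 + (c * ((2 + k) ^ k * P) + c) ≡ B * P + (c + 2)
  rearrange = solve 3 (λ c K P → con 2 :+ (c :* (K :* P) :+ c) := (c :* K) :* P :+ (c :+ con 2))
                    refl c ((2 + k) ^ k) P
    where open +-*-Solver

allOnes : ℕ → List Bool
allOnes L = replicate (2 ^ L) true

⌈log₂∣allOnes∣⌉ : ∀ L → ⌈log₂ length (allOnes L) ⌉ ≡ L
⌈log₂∣allOnes∣⌉ L = trans (cong ⌈log₂_⌉ (length-replicate (2 ^ L))) (⌈log₂2^n⌉≡n L)

readInput-allOnes : ∀ L r → readInput (allOnes L) r ≢ just false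
readInput-allOnes L = nonzero (2 ^ L)
  where
  nonzero : ∀ n r → readInput (replicate n true) r ≢ just false
  nonzero zero    _       ()
  nonzero (suc n) zero    ()
  nonzero (suc n) (suc r) = nonzero n r

probes-<2^ : ∀ e h {i} → i ∈ probes e h 1 → i < 2 ^ suc h
probes-<2^ e h {i} i∈ =
  s≤s⁻¹ (≤-trans (≤-reflexive (+-comm 2 i)) (proj₂ (All.lookup (probes-inWindow e h 1) i∈)))

module _ (k : ℕ) where
  open Enumerator k

  Accepts-zero-probe : ∀ x L′ {i} → ⌈log₂ length x ⌉ ≡ suc L′ → i ∈ probes k L′ 1 →
    readInput x i ≡ just false → Accepts M x
  Accepts-zero-probe x L′ L≡ i∈ isZero = Reaches-Acc (run L′ L≡) (Outcome-Acc i∈ isZero)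
    where open Execution k x

  ¬Accepts-no-zero : ∀ x → (∀ r → readInput x r ≢ just false) → ¬ Accepts M x
  ¬Accepts-no-zero x nonzero with ⌈log₂ length x ⌉ in L≡
  ... | zero   = Reaches-¬Acc (run-empty L≡) (Outcome-¬Acc nonzero)
    where open Execution k x
  ... | suc L′ = Reaches-¬Acc (run L′ L≡) (Outcome-¬Acc nonzero)
    where open Execution k x

  enumerator-bounded : ∀ x → BoundedBy M x ((8 ^ suc k + 3) * (logPow (suc k) (length x) + 1)) (initial M)
  enumerator-bounded x with ⌈log₂ length x ⌉ in L≡
  ... | zero   = BoundedBy-mono M x (initial M) z≤n (Reaches⇒BoundedBy (run-empty L≡) Outcome-halts)
    where open Execution k x
  ... | suc L′ = BoundedBy-mono M x (initial M)
                   (≤-trans (≤-reflexive (cong (λ L → runTime k L L′) L≡)) (runTime-bound k L′))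
                   (Reaches⇒BoundedBy (run L′ L≡) Outcome-halts)
    where open Execution k x

  enumerator-∈ : ATIME1 (logPow (suc k)) (Accepts M)
  enumerator-∈ = M , refl , phaseKind≢existential ∘ state , (8 ^ suc k + 3 , enumerator-bounded) ,
                 λ _ → mk⇔ (λ a → a) (λ a → a)

  enumerator-∉ : ¬ ATIME1 (logPow k) (Accepts M)
  enumerator-∉ (N , _ , noExistential , (c , bounded) , language) =
    ¬Accepts-no-zero x (readInput-allOnes (suc L′)) (Equivalence.from (language x) xAccepted)
    where
    L′ : ℕ
    L′ = suc k * blockSize c k
    x : List Bool
    x = allOnes (suc L′)
    t : ℕ
    t = c * (logPow k (length x) + 1)
    enoughProbes : 2 + t ≤ length (probes k L′ 1)
    enoughProbes = begin
      2 + t                     ≡⟨ cong (λ L → 2 + c * (L ^ k + 1)) (⌈log₂∣allOnes∣⌉ (suc L′)) ⟩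
      2 + c * (suc L′ ^ k + 1)  ≤⟨ budget<blockSize^ c k ⟩
      blockSize c k ^ suc k     ≤⟨ ^≤probeCount k (blockSize c k) ⟩
      probeCount k L′           ≡⟨ sym (length-probes k L′ 1) ⟩
      length (probes k L′ 1)    ∎
      where open ≤-Reasoning
    zeroingsAccepted : ZeroingsAccepted N noExistential x t (initial N)
    zeroingsAccepted R ∣R∣≤ with ∃-∈-∉ R (probes-unique k L′ 1) (≤-trans (s≤s ∣R∣≤) enoughProbes)
    ... | i , i∈ , i∉R =
      i , i∉R ,
      Equivalence.to (language (zeroAt x i))
        (Accepts-zero-probe (zeroAt x i) L′
          (trans (cong ⌈log₂_⌉ (length-zeroAt x i)) (⌈log₂∣allOnes∣⌉ (suc L′))) i∈
          (readInput-zeroAt x (subst (i <_) (sym (length-replicate (2 ^ suc L′))) (probes-<2^ k L′ i∈))))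
    xAccepted : Accepts N x
    xAccepted = Acc-of-zeroings N noExistential x t (initial N) (bounded x) zeroingsAccepted

theorem3 : ∀ (k : ℕ) → 1 < k → ATIME1 (logPow k) ⊊ᶜ ATIME1 (logPow (suc k))
theorem3 k 1<k =
  ATIME1-mono (logPow-mono (<⇒≤ 1<k)) ,
  Accepts (Enumerator.M k) , enumerator-∈ k , enumerator-∉ k
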